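{- Let $\sigma$ be a signature, $\varphi$ a $\mathcal{COD}[\sigma]$-formula, $\mathbf d$ a sequence of occurrences of constancy atoms in $\varphi$, and $F$ the set of all instantiating functions over $\mathbf d$. Then $\varphi\equiv\bigsqcup_{f\in F}\varphi_f$, over generalized causal teams and over causal teams.
   Context: Signature $\sigma=(\mathrm{Dom},\mathrm{Ran})$, $\mathrm{Dom}$ nonempty finite, $\mathrm{Ran}(X)$ nonempty finite. $\mathbf X=\mathbf x$ abbreviates $X_1=x_1\wedge\dots\wedge X_n=x_n$, inconsistent if two conjuncts give one variable distinct values. Systems of functions $\mathcal F$: for $V\in\mathrm{En}(\mathcal F)\subseteq\mathrm{Dom}$, parents $PA^{\mathcal F}_V\subseteq\mathrm{Dom}\setminus\{V\}$ and $\mathcal F_V:\mathrm{Ran}(PA^{\mathcal F}_V)\to\mathrm{Ran}(V)$; recursive if the parent graph is acyclic; $s$ compatible if $s(V)=\mathcal F_V(s(PA^{\mathcal F}_V))$ for endogenous $V$. Causal team: $(T^-,\mathcal F)$, $\mathcal F$ recursive, $T^-$ a set of compatible assignments; generalized causal team: set of pairs $(s,\mathcal F)$, $\mathcal F$ recursive, $s$ compatible. Intervention (consistent $\mathbf X=\mathbf x$): $\mathcal F_{\mathbf X=\mathbf x}$ restricts $\mathcal F$ to $\mathrm{En}(\mathcal F)\setminus\mathbf X$; $s^{\mathcal F}_{\mathbf X=\mathbf x}$ is $x_i$ on $X_i$, $s(V)$ on non-intervened exogenous $V$, recursively $\mathcal F_V(s^{\mathcal F}_{\mathbf X=\mathbf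 x}(PA^{\mathcal F}_V))$ otherwise; elementwise on teams. $\mathcal{CO}[\sigma]$: $\alpha::=X=x\mid\neg\alpha\mid\alpha\wedge\alpha\mid\alpha\vee\alpha\mid\mathbf X=\mathbf x\;\Box\!\!\rightarrow\alpha$; $\mathcal{COD}[\sigma]$: $\varphi::=X=x\mid{=}(\mathbf X;Y)\mid\neg\alpha\mid\varphi\wedge\varphi\mid\varphi\vee\varphi\mid\mathbf X=\mathbf x\;\Box\!\!\rightarrow\varphi$; ${=}(Y)$ denotes ${=}(;Y)$ (constancy atom). Semantics: $X=x$ iff all assignments of the team give $X$ value $x$; ${=}(\mathbf X;Y)$ iff any two assignments of the team agreeing on $\mathbf X$ agree on $Y$; $\neg\alpha$ iff every singleton subteam fails $\alpha$; $\wedge$ usual; $\varphi\vee\psi$ iff the team is the union of two subteams satisfying $\varphi$, $\psi$ (for causal teams: subteams with the same $\mathcal F$); $\varphi\sqcup\psi$ (global disjunction, $\bigsqcup$ iterated) iff the team satisfies $\varphi$ or $\psi$; $\mathbf X=\mathbf x\;\Box\!\!\rightarrow\varphi$ iff antecedent inconsistent or the intervened team satisfies $\varphi$. $\equiv$: satisfied by the same teams. If $\mathbf d=\langle[{=}(X_1),k_1],\dots,[{=}(X_n),k_n]\rangle$ lists occurrences (the $k_i$-th occurrence of ${=}(X_i)$) of constancy atoms in $\varphi$, an instantiating function over $\mathbf d$ is $f:\{1,\dots,n\}\to\bigcup_i\mathrm{Ran}(X_i)$ with $f(i)\in\mathrm{Ran}(X_i)$, and $\varphi_f$ is the formula obtained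 from $\varphi$ by replacing, for each $i$, the $k_i$-th occurrence of ${=}(X_i)$ by $X_i=f(i)$. -}

module Defs where

open import Data.Nat using (ℕ; zero; suc; _≤_)
open import Data.Fin using (Fin; zero; suc)
open import Data.Fin.Properties using () renaming (_≟_ to _≟ᶠ_)
open import Data.Nat.Properties using () renaming (_≟_ to _≟ⁿ_)
open import Data.Bool using (Bool; true; false; T; not; if_then_else_)
open import Data.Maybe using (Maybe; just; nothing)
open import Data.List using (List; []; _∷_; [_]; length; lookup)
open import Data.List.Relation.Unary.All using (All)
open import Data.List.Relation.Unary.Any using (Any)
open import Data.List.Relation.Binary.Pointwise using (Pointwise)
open import Data.Product using (Σ; _×_; _,_; proj₁; proj₂; ∃)
open import Data.Sum using (_⊎_)
open import Data.Empty using (⊥)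
open import Relation.Nullary using (¬_; yes; no)
open import Relation.Binary.PropositionalEquality using (_≡_; _≢_; subst)
open import Relation.Binary.Construct.Closure.Transitive using (TransClosure)

-- Signatures.  Dom = Fin (suc size)  (nonempty, finite);
-- Ran(V) = Fin (suc (rng V))          (nonempty, finite).

record Sig : Set where
  field
    size : ℕ
    rng  : Fin (suc size) → ℕ

module _ (σ : Sig) where
  open Sig σ

  Var : Set
  Var = Fin (suc size)

  Val : Var → Set
  Val V = Fin (suc (rng V))

  Assignment : Set
  Assignment = (V : Var) → Val V

  -- an element of Ran(PA) for a set of variables PA (given by its
  -- characteristic function): an assignment to the variables of PA
  RanOf : (Var → Bool) → Set
  RanOf pa = (W : Var) → T (pa W) → Val W

  restrict : (pa : Var → Bool) → Assignment → RanOf pa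
  restrict pa s W _ = s W

  record Mech (V : Var) : Set where
    field
      pa     : Var → Bool
      noSelf : pa V ≡ false
      fn     : RanOf pa → Val V

  -- system of functions: sys V = just m iff V ∈ En(F) with mechanism m
  System : Set
  System = (V : Var) → Maybe (Mech V)

  ParentOf : System → Var → Var → Set
  ParentOf F W V with F V
  ... | nothing = ⊥
  ... | just m  = T (Mech.pa m W)

  Recursive : System → Set
  Recursive F = ∀ V → ¬ TransClosure (ParentOf F) V V

  CompatAt : (V : Var) → Maybe (Mech V) → Assignment → Set
  CompatAt V nothing  s = Data.Unit.⊤ where import Data.Unit
  CompatAt V (just m) s = s V ≡ Mech.fn m (restrict (Mech.pa m) s)

  Compatible : System → Assignment → Set
  Compatible F s = ∀ V → CompatAt V (F V) s

  Ante : Set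
  Ante = List (Σ Var Val)

  intervened : Ante → Var → Bool
  intervened []            V = false
  intervened ((X , _) ∷ A) V with X ≟ᶠ V
  ... | yes _ = true
  ... | no  _ = intervened A V

  Inconsistent : Ante → Set
  Inconsistent A = Σ Var λ X → Σ (Val X) λ x → Σ (Val X) λ x′ →
    x ≢ x′ × Any (λ p → p ≡ (X , x)) A × Any (λ p → p ≡ (X , x′)) A

  intervSys : Ante → System → System
  intervSys A F V = if intervened A V then nothing else F V

  -- t = s^F_{X=x}, given by its defining (recursive) equations:
  -- t(Xᵢ) = xᵢ; t(V) = s(V) for non-intervened exogenous V;
  -- t(V) = F_V(t(PA_V)) for non-intervened endogenous V.
  ResAt : (V : Var) → Maybe (Mech V) → Assignment → Assignment → Set
  ResAt V nothing  s t = t V ≡ s V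
  ResAt V (just m) s t = t V ≡ Mech.fn m (restrict (Mech.pa m) t)

  IntervRes : System → Ante → Assignment → Assignment → Set
  IntervRes F A s t =
    All (λ p → t (proj₁ p) ≡ proj₂ p) A ×
    (∀ V → intervened A V ≡ false → ResAt V (F V) s t)

  infixr 6 _□→_ _□→ᶜ_

  data CO : Set where
    _≐_  : (X : Var) → Val X → CO
    ¬ᶜ_  : CO → CO
    _∧ᶜ_ : CO → CO → CO
    _∨ᶜ_ : CO → CO → CO
    _□→ᶜ_ : Ante → CO → CO

  data COD : Set where
    _≐_  : (X : Var) → Val X → COD
    dep  : List Var → Var → COD
    neg  : CO → COD
    _∧_  : COD → COD → COD
    _∨_  : COD → COD → COD
    _□→_ : Ante → COD → COD

  const : Var → COD
  const Y = dep [] Y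

  -- Team splitting: T = T₁ ∪ T₂ with T₁, T₂ ⊆ T (teams as finite lists)

  data Split {A : Set} : List A → List A → List A → Set where
    []    : Split [] [] []
    left  : ∀ {x T T₁ T₂} → Split T T₁ T₂ → Split (x ∷ T) (x ∷ T₁) T₂
    right : ∀ {x T T₁ T₂} → Split T T₁ T₂ → Split (x ∷ T) T₁ (x ∷ T₂)
    both  : ∀ {x T T₁ T₂} → Split T T₁ T₂ → Split (x ∷ T) (x ∷ T₁) (x ∷ T₂)

  AgreeOn : List Var → Assignment → Assignment → Set
  AgreeOn Xs s s′ = All (λ X → s X ≡ s′ X) Xs

  CTeam : Set
  CTeam = List Assignment

  IsCausalTeam : System → CTeam → Set
  IsCausalTeam F T = Recursive F × All (Compatible F) T

  csatCO : System → CTeam → CO → Set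
  csatCO F T (X ≐ x)   = All (λ s → s X ≡ x) T
  csatCO F T (¬ᶜ α)    = All (λ s → ¬ csatCO F [ s ] α) T
  csatCO F T (α ∧ᶜ β)  = csatCO F T α × csatCO F T β
  csatCO F T (α ∨ᶜ β)  = Σ CTeam λ T₁ → Σ CTeam λ T₂ →
    Split T T₁ T₂ × csatCO F T₁ α × csatCO F T₂ β
  csatCO F T (A □→ᶜ α) = Inconsistent A ⊎
    Σ CTeam λ T′ → Pointwise (IntervRes F A) T T′ × csatCO (intervSys A F) T′ α

  csat : System → CTeam → COD → Set
  csat F T (X ≐ x)    = All (λ s → s X ≡ x) T
  csat F T (dep Xs Y) = All (λ s → All (λ s′ → AgreeOn Xs s s′ → s Y ≡ s′ Y) T) T
  csat F T (neg α)      = All (λ s → ¬ csatCO F [ s ] α) T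
  csat F T (φ ∧ ψ)    = csat F T φ × csat F T ψ
  csat F T (φ ∨ ψ)    = Σ CTeam λ T₁ → Σ CTeam λ T₂ →
    Split T T₁ T₂ × csat F T₁ φ × csat F T₂ ψ
  csat F T (A □→ φ)   = Inconsistent A ⊎
    Σ CTeam λ T′ → Pointwise (IntervRes F A) T T′ × csat (intervSys A F) T′ φ

  GTeam : Set
  GTeam = List (Assignment × System)

  IsGenCausalTeam : GTeam → Set
  IsGenCausalTeam T = All (λ p → Recursive (proj₂ p) × Compatible (proj₂ p) (proj₁ p)) T

  GIntervRes : Ante → Assignment × System → Assignment × System → Set
  GIntervRes A (s , F) (t , G) = IntervRes F A s t × G ≡ intervSys A F

  gsatCO : GTeam → CO → Set
  gsatCO T (X ≐ x)   = All (λ p → proj₁ p X ≡ x) T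
  gsatCO T (¬ᶜ α)    = All (λ p → ¬ gsatCO [ p ] α) T
  gsatCO T (α ∧ᶜ β)  = gsatCO T α × gsatCO T β
  gsatCO T (α ∨ᶜ β)  = Σ GTeam λ T₁ → Σ GTeam λ T₂ →
    Split T T₁ T₂ × gsatCO T₁ α × gsatCO T₂ β
  gsatCO T (A □→ᶜ α) = Inconsistent A ⊎
    Σ GTeam λ T′ → Pointwise (GIntervRes A) T T′ × gsatCO T′ α

  gsat : GTeam → COD → Set
  gsat T (X ≐ x)    = All (λ p → proj₁ p X ≡ x) T
  gsat T (dep Xs Y) = All (λ p → All (λ p′ →
    AgreeOn Xs (proj₁ p) (proj₁ p′) → proj₁ p Y ≡ proj₁ p′ Y) T) T
  gsat T (neg α)      = All (λ p → ¬ gsatCO [ p ] α) T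
  gsat T (φ ∧ ψ)    = gsat T φ × gsat T ψ
  gsat T (φ ∨ ψ)    = Σ GTeam λ T₁ → Σ GTeam λ T₂ →
    Split T T₁ T₂ × gsat T₁ φ × gsat T₂ ψ
  gsat T (A □→ φ)   = Inconsistent A ⊎
    Σ GTeam λ T′ → Pointwise (GIntervRes A) T T′ × gsat T′ φ

  csat⨆ : System → CTeam → (I : Set) → (I → COD) → Set
  csat⨆ F T I φs = Σ I λ i → csat F T (φs i)

  gsat⨆ : GTeam → (I : Set) → (I → COD) → Set
  gsat⨆ T I φs = Σ I λ i → gsat T (φs i)

  -- Occurrences of constancy atoms.  An occurrence [=(X), k] is the k-th
  -- (1-based, counting left to right) occurrence of =( ; X) in φ.

  Occ : Set
  Occ = Σ Var λ _ → ℕ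

  countConst : COD → Var → ℕ
  countConst (X ≐ x)     Y = 0
  countConst (dep [] X)  Y with X ≟ᶠ Y
  ... | yes _ = 1
  ... | no  _ = 0
  countConst (dep (_ ∷ _) X) Y = 0
  countConst (neg α)       Y = 0
  countConst (φ ∧ ψ)     Y = countConst φ Y Data.Nat.+ countConst ψ Y
    where import Data.Nat
  countConst (φ ∨ ψ)     Y = countConst φ Y Data.Nat.+ countConst ψ Y
    where import Data.Nat
  countConst (A □→ φ)    Y = countConst φ Y

  OccurrencesIn : COD → List Occ → Set
  OccurrencesIn φ d = All (λ o → 1 ≤ proj₂ o × proj₂ o ≤ countConst φ (proj₁ o)) d

  InstFun : List Occ → Set
  InstFun d = (i : Fin (length d)) → Val (proj₁ (lookup d i))

  findOcc : (d : List Occ) → (X : Var) → ℕ →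
            Maybe (Σ (Fin (length d)) λ i → proj₁ (lookup d i) ≡ X)
  findOcc []            X k = nothing
  findOcc ((Y , j) ∷ d) X k with Y ≟ᶠ X | j ≟ⁿ k
  ... | yes e | yes _ = just (zero , e)
  ... | _     | _     with findOcc d X k
  ...   | nothing      = nothing
  ...   | just (i , e) = just (suc i , e)

  -- φ_f : replace the k_i-th occurrence of =(X_i) by X_i = f(i).
  -- The counter c records how many occurrences of each =(X) have been
  -- passed so far (left-to-right traversal).
  bump : (Var → ℕ) → Var → Var → ℕ
  bump c X Y with X ≟ᶠ Y
  ... | yes _ = suc (c Y)
  ... | no  _ = c Y

  instGo : (d : List Occ) → InstFun d → (Var → ℕ) → COD → COD × (Var → ℕ)
  instGo d f c (X ≐ x)         = (X ≐ x) , c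
  instGo d f c (dep [] X) with findOcc d X (suc (c X))
  ... | nothing      = dep [] X , bump c X
  ... | just (i , e) = (X ≐ subst Val e (f i)) , bump c X
  instGo d f c (dep (Z ∷ Zs) X) = dep (Z ∷ Zs) X , c
  instGo d f c (neg α)           = (neg α) , c
  instGo d f c (φ ∧ ψ) with instGo d f c φ
  ... | φ′ , c′ with instGo d f c′ ψ
  ...   | ψ′ , c″ = (φ′ ∧ ψ′) , c″
  instGo d f c (φ ∨ ψ) with instGo d f c φ
  ... | φ′ , c′ with instGo d f c′ ψ
  ...   | ψ′ , c″ = (φ′ ∨ ψ′) , c″
  instGo d f c (A □→ φ) with instGo d f c φ
  ... | φ′ , c′ = (A □→ φ′) , c′

  inst : (φ : COD) → (d : List Occ) → InstFun d → COD
  inst φ d f = proj₁ (instGo d f (λ _ → 0) φ)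

  EquivCausal⨆ : COD → (I : Set) → (I → COD) → Set
  EquivCausal⨆ φ I φs = ∀ F T → IsCausalTeam F T →
    (csat F T φ → csat⨆ F T I φs) × (csat⨆ F T I φs → csat F T φ)

  EquivGen⨆ : COD → (I : Set) → (I → COD) → Set
  EquivGen⨆ φ I φs = ∀ T → IsGenCausalTeam T →
    (gsat T φ → gsat⨆ T I φs) × (gsat⨆ T I φs → gsat T φ)

-- A constancy atom =(X) is equivalent to the global disjunction of the atoms
-- X = v, v ∈ Ran(X), and every connective of COD commutes with global
-- disjunction, the disjunct being chosen separately for each argument (per
-- subteam for ∨, in the intervened team for □→).  The instantiating functions
-- chosen for the two halves of φ ∧ ψ or φ ∨ ψ can be spliced into one, because
-- the instantiation of a subformula only reads the entries of d that point
-- into that subformula.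
module Submission where

open import Defs
open import Data.Empty using (⊥-elim)
open import Data.Fin using (Fin; zero)
open import Data.Fin.Properties using () renaming (_≟_ to _≟ᶠ_)
open import Data.List using (List; []; _∷_; length; lookup)
open import Data.List.Relation.Unary.All as All using (All; []; _∷_)
open import Data.Maybe using (just; nothing)
open import Data.Nat using (ℕ; suc; _≤_; _<_; _≤?_)
open import Data.Nat.Properties
  using (≤-refl; ≤-trans; ≤-<-trans; n≤1+n; <⇒≱; ≤-reflexive) renaming (_≟_ to _≟ⁿ_)
open import Data.Product using (Σ; _×_; _,_; proj₁; proj₂; uncurry)
open import Data.Sum using (inj₁; inj₂)
open import Data.Unit using (⊤; tt)
open import Relation.Nullary using (yes; no)
open import Relation.Binary.PropositionalEquality

module Instantiation (σ : Sig) (d : List (Occ σ)) where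

  Counter : Set
  Counter = Var σ → ℕ

  _≤ᶜ_ : Counter → Counter → Set
  c ≤ᶜ c′ = ∀ X → c X ≤ c′ X

  advance : Counter → COD σ → Counter
  advance c (X ≐ x)         = c
  advance c (dep [] X)      = bump σ c X
  advance c (dep (_ ∷ _) X) = c
  advance c (neg α)         = c
  advance c (φ ∧ ψ)         = advance (advance c φ) ψ
  advance c (φ ∨ ψ)         = advance (advance c φ) ψ
  advance c (A □→ φ)        = advance c φ

  instantiate : InstFun σ d → Counter → COD σ → COD σ
  instantiate f c φ = proj₁ (instGo σ d f c φ)

  occVar : Fin (length d) → Var σ
  occVar j = proj₁ (lookup d j)

  occIndex : Fin (length d) → ℕ
  occIndex j = proj₂ (lookup d j)

  defaultInst : InstFun σ d
  defaultInst _ = zero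

  pointAt : (i : Fin (length d)) → Val σ (occVar i) → InstFun σ d
  pointAt i v j with i ≟ᶠ j
  ... | yes refl = v
  ... | no _     = zero

  pointAt-self : ∀ i v → pointAt i v i ≡ v
  pointAt-self i v with i ≟ᶠ i
  ... | yes refl = refl
  ... | no i≢i   = ⊥-elim (i≢i refl)

  findOcc-index : ∀ (d′ : List (Occ σ)) X k {i e} →
                  findOcc σ d′ X k ≡ just (i , e) → proj₂ (lookup d′ i) ≡ k
  findOcc-index ((Y , j) ∷ d′) X k eq with Y ≟ᶠ X | j ≟ⁿ k
  findOcc-index ((Y , j) ∷ d′) X k refl | yes _ | yes j≡k = j≡k
  ... | yes _ | no _ with findOcc σ d′ X k in found
  findOcc-index ((Y , j) ∷ d′) X k refl | yes _ | no _ | just _ = findOcc-index d′ X k found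
  findOcc-index ((Y , j) ∷ d′) X k eq | no _ | _ with findOcc σ d′ X k in found
  findOcc-index ((Y , j) ∷ d′) X k refl | no _ | _ | just _ = findOcc-index d′ X k found

  bump-self : ∀ c X → bump σ c X X ≡ suc (c X)
  bump-self c X with X ≟ᶠ X
  ... | yes _   = refl
  ... | no X≢X = ⊥-elim (X≢X refl)

  bump-mono : ∀ c X → c ≤ᶜ bump σ c X
  bump-mono c X Y with X ≟ᶠ Y
  ... | yes _ = n≤1+n _
  ... | no _  = ≤-refl

  advance-mono : ∀ φ c → c ≤ᶜ advance c φ
  advance-mono (X ≐ x)         c Y = ≤-refl
  advance-mono (dep [] X)      c Y = bump-mono c X Y
  advance-mono (dep (_ ∷ _) X) c Y = ≤-refl
  advance-mono (neg α)         c Y = ≤-refl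
  advance-mono (φ ∧ ψ)         c Y = ≤-trans (advance-mono φ c Y) (advance-mono ψ (advance c φ) Y)
  advance-mono (φ ∨ ψ)         c Y = ≤-trans (advance-mono φ c Y) (advance-mono ψ (advance c φ) Y)
  advance-mono (A □→ φ)        c Y = advance-mono φ c Y

  instGo-counter : ∀ f c φ → proj₂ (instGo σ d f c φ) ≡ advance c φ
  instGo-counter f c (X ≐ x) = refl
  instGo-counter f c (dep [] X) with findOcc σ d X (suc (c X))
  ... | nothing = refl
  ... | just _  = refl
  instGo-counter f c (dep (_ ∷ _) X) = refl
  instGo-counter f c (neg α) = refl
  instGo-counter f c (φ ∧ ψ) =
    trans (cong (λ c′ → proj₂ (instGo σ d f c′ ψ)) (instGo-counter f c φ))
          (instGo-counter f (advance c φ) ψ)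
  instGo-counter f c (φ ∨ ψ) =
    trans (cong (λ c′ → proj₂ (instGo σ d f c′ ψ)) (instGo-counter f c φ))
          (instGo-counter f (advance c φ) ψ)
  instGo-counter f c (A □→ φ) = instGo-counter f c φ

  instantiate-∧ : ∀ f c φ ψ →
                  instantiate f c (φ ∧ ψ) ≡ instantiate f c φ ∧ instantiate f (advance c φ) ψ
  instantiate-∧ f c φ ψ = cong (λ c′ → instantiate f c φ ∧ instantiate f c′ ψ) (instGo-counter f c φ)

  instantiate-∨ : ∀ f c φ ψ →
                  instantiate f c (φ ∨ ψ) ≡ instantiate f c φ ∨ instantiate f (advance c φ) ψ
  instantiate-∨ f c φ ψ = cong (λ c′ → instantiate f c φ ∨ instantiate f c′ ψ) (instGo-counter f c φ)

  AgreeBetween : Counter → Counter → InstFun σ d → InstFun σ d → Set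
  AgreeBetween lo hi f f′ =
    ∀ j → lo (occVar j) < occIndex j → occIndex j ≤ hi (occVar j) → f j ≡ f′ j

  AgreeBetween-narrow : ∀ {lo lo′ hi hi′ f f′} → lo ≤ᶜ lo′ → hi′ ≤ᶜ hi →
                        AgreeBetween lo hi f f′ → AgreeBetween lo′ hi′ f f′
  AgreeBetween-narrow lo≤lo′ hi′≤hi agree j lo′<k k≤hi′ =
    agree j (≤-<-trans (lo≤lo′ _) lo′<k) (≤-trans k≤hi′ (hi′≤hi _))

  mutual
    instantiate-cong : ∀ φ c {f f′} → AgreeBetween c (advance c φ) f f′ →
                       instantiate f c φ ≡ instantiate f′ c φ
    instantiate-cong (X ≐ x) c agree = refl
    instantiate-cong (dep [] X) c agree with findOcc σ d X (suc (c X)) in found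
    ... | nothing        = refl
    ... | just (i , refl) = cong (occVar i ≐_) (agree i
          (≤-reflexive (sym (findOcc-index d X _ found)))
          (≤-reflexive (trans (findOcc-index d X _ found) (sym (bump-self c X)))))
    instantiate-cong (dep (_ ∷ _) X) c agree = refl
    instantiate-cong (neg α) c agree = refl
    instantiate-cong (φ ∧ ψ) c {f} {f′} agree = begin
      instantiate f c (φ ∧ ψ)                               ≡⟨ instantiate-∧ f c φ ψ ⟩
      instantiate f c φ ∧ instantiate f (advance c φ) ψ     ≡⟨ uncurry (cong₂ _∧_) (instantiate-cong-halves φ ψ c agree) ⟩
      instantiate f′ c φ ∧ instantiate f′ (advance c φ) ψ   ≡⟨ instantiate-∧ f′ c φ ψ ⟨
      instantiate f′ c (φ ∧ ψ)                              ∎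
      where open ≡-Reasoning
    instantiate-cong (φ ∨ ψ) c {f} {f′} agree = begin
      instantiate f c (φ ∨ ψ)                               ≡⟨ instantiate-∨ f c φ ψ ⟩
      instantiate f c φ ∨ instantiate f (advance c φ) ψ     ≡⟨ uncurry (cong₂ _∨_) (instantiate-cong-halves φ ψ c agree) ⟩
      instantiate f′ c φ ∨ instantiate f′ (advance c φ) ψ   ≡⟨ instantiate-∨ f′ c φ ψ ⟨
      instantiate f′ c (φ ∨ ψ)                              ∎
      where open ≡-Reasoning
    instantiate-cong (A □→ φ) c agree = cong (A □→_) (instantiate-cong φ c agree)

    instantiate-cong-halves : ∀ φ ψ c {f f′} → AgreeBetween c (advance (advance c φ) ψ) f f′ →
                              instantiate f c φ ≡ instantiate f′ c φ ×
                              instantiate f (advance c φ) ψ ≡ instantiate f′ (advance c φ) ψ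
    instantiate-cong-halves φ ψ c agree =
      instantiate-cong φ c (AgreeBetween-narrow {lo = c} (λ _ → ≤-refl) (advance-mono ψ (advance c φ)) agree) ,
      instantiate-cong ψ (advance c φ) (AgreeBetween-narrow {hi = advance (advance c φ) ψ} (advance-mono φ c) (λ _ → ≤-refl) agree)

  splice : Counter → InstFun σ d → InstFun σ d → InstFun σ d
  splice hi f g j with occIndex j ≤? hi (occVar j)
  ... | yes _ = f j
  ... | no _  = g j

  splice-below : ∀ lo hi f g → AgreeBetween lo hi (splice hi f g) f
  splice-below lo hi f g j _ k≤hi with occIndex j ≤? hi (occVar j)
  ... | yes _ = refl
  ... | no k≰hi = ⊥-elim (k≰hi k≤hi)

  splice-above : ∀ hi hi′ f g → AgreeBetween hi hi′ (splice hi f g) g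
  splice-above hi hi′ f g j hi<k _ with occIndex j ≤? hi (occVar j)
  ... | yes k≤hi = ⊥-elim (<⇒≱ hi<k k≤hi)
  ... | no _     = refl

  instantiate-splice : ∀ φ ψ c f g →
                       instantiate (splice (advance c φ) f g) c φ ≡ instantiate f c φ ×
                       instantiate (splice (advance c φ) f g) (advance c φ) ψ ≡ instantiate g (advance c φ) ψ
  instantiate-splice φ ψ c f g =
    instantiate-cong φ c (splice-below c (advance c φ) f g) ,
    instantiate-cong ψ (advance c φ) (splice-above (advance c φ) (advance (advance c φ) ψ) f g)

module _ {σ : Sig} {Team : Set} (_⊨_ : Team → COD σ → Set) where

  Entails⨆ : {A : Set} → COD σ → (A → COD σ) → Set
  Entails⨆ {A} φ ψs = ∀ {T} → T ⊨ φ → Σ A λ a → T ⊨ ψs a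

  Entails⨆-refl : ∀ {A φ} → A → Entails⨆ φ (λ (_ : A) → φ)
  Entails⨆-refl a h = a , h

  Entails⨆-reindex : ∀ {A B φ} {ψs : A → COD σ} {χs : B → COD σ} (g : A → B) →
                     (∀ a → ψs a ≡ χs (g a)) → Entails⨆ φ ψs → Entails⨆ φ χs
  Entails⨆-reindex g eq entails h with entails h
  ... | a , h′ = g a , subst (_ ⊨_) (eq a) h′

  record Compositional : Set₁ where
    field
      const-elim  : ∀ {X} → Entails⨆ (const σ X) (X ≐_)
      const-intro : ∀ {T X v} → T ⊨ (X ≐ v) → T ⊨ const σ X
      ∧-entails⨆  : ∀ {A B φ ψ} {φs : A → COD σ} {ψs : B → COD σ} →
                    Entails⨆ φ φs → Entails⨆ ψ ψs →
                    Entails⨆ (φ ∧ ψ) (λ (ab : A × B) → φs (proj₁ ab) ∧ ψs (proj₂ ab))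
      ∨-entails⨆  : ∀ {A B φ ψ} {φs : A → COD σ} {ψs : B → COD σ} →
                    Entails⨆ φ φs → Entails⨆ ψ ψs →
                    Entails⨆ (φ ∨ ψ) (λ (ab : A × B) → φs (proj₁ ab) ∨ ψs (proj₂ ab))
      -- the witness in A serves inconsistent antecedents, which every team satisfies
      □→-entails⨆ : ∀ {A Ante φ} {φs : A → COD σ} → A →
                    Entails⨆ φ φs → Entails⨆ (Ante □→ φ) (λ a → Ante □→ φs a)

open Compositional

gsat-compositional : ∀ {σ} → Compositional (gsat σ)
gsat-compositional .const-elim {T = []} _ = zero , []
gsat-compositional .const-elim {X} {T = (s , _) ∷ _} (h ∷ _) = s X , All.map (λ q → sym (q [])) h
gsat-compositional .const-intro h = All.map (λ q → All.map (λ q′ _ → trans q (sym q′)) h) h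
gsat-compositional .∧-entails⨆ e₁ e₂ (h₁ , h₂) =
  let (a , r₁) = e₁ h₁ ; (b , r₂) = e₂ h₂ in (a , b) , r₁ , r₂
gsat-compositional .∨-entails⨆ e₁ e₂ (T₁ , T₂ , split , h₁ , h₂) =
  let (a , r₁) = e₁ h₁ ; (b , r₂) = e₂ h₂ in (a , b) , T₁ , T₂ , split , r₁ , r₂
gsat-compositional .□→-entails⨆ a e (inj₁ inconsistent) = a , inj₁ inconsistent
gsat-compositional .□→-entails⨆ a e (inj₂ (T′ , result , h)) =
  let (b , r) = e h in b , inj₂ (T′ , result , r)

csat-compositional : ∀ {σ} → Compositional (uncurry (csat σ))
csat-compositional .const-elim {T = _ , []} _ = zero , []
csat-compositional .const-elim {X} {T = _ , s ∷ _} (h ∷ _) = s X , All.map (λ q → sym (q [])) h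
csat-compositional .const-intro h = All.map (λ q → All.map (λ q′ _ → trans q (sym q′)) h) h
csat-compositional .∧-entails⨆ e₁ e₂ (h₁ , h₂) =
  let (a , r₁) = e₁ h₁ ; (b , r₂) = e₂ h₂ in (a , b) , r₁ , r₂
csat-compositional .∨-entails⨆ e₁ e₂ (T₁ , T₂ , split , h₁ , h₂) =
  let (a , r₁) = e₁ h₁ ; (b , r₂) = e₂ h₂ in (a , b) , T₁ , T₂ , split , r₁ , r₂
csat-compositional .□→-entails⨆ a e (inj₁ inconsistent) = a , inj₁ inconsistent
csat-compositional .□→-entails⨆ a e (inj₂ (T′ , result , h)) =
  let (b , r) = e h in b , inj₂ (T′ , result , r)

module InstantiationEquivalence {σ : Sig} {Team : Set} {_⊨_ : Team → COD σ → Set}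
                                (sem : Compositional _⊨_) (d : List (Occ σ)) where

  open Instantiation σ d

  instantiate-sound : ∀ φ c f → Entails⨆ _⊨_ (instantiate f c φ) (λ (_ : ⊤) → φ)
  instantiate-sound (X ≐ x) c f = Entails⨆-refl _⊨_ tt
  instantiate-sound (dep [] X) c f with findOcc σ d X (suc (c X))
  ... | nothing         = Entails⨆-refl _⊨_ tt
  ... | just (_ , refl) = λ h → tt , const-intro sem h
  instantiate-sound (dep (_ ∷ _) X) c f = Entails⨆-refl _⊨_ tt
  instantiate-sound (neg α) c f = Entails⨆-refl _⊨_ tt
  instantiate-sound (φ ∧ ψ) c f = Entails⨆-reindex _⊨_ _ (λ _ → refl)
    (∧-entails⨆ sem (instantiate-sound φ c f) (instantiate-sound ψ (proj₂ (instGo σ d f c φ)) f))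
  instantiate-sound (φ ∨ ψ) c f = Entails⨆-reindex _⊨_ _ (λ _ → refl)
    (∨-entails⨆ sem (instantiate-sound φ c f) (instantiate-sound ψ (proj₂ (instGo σ d f c φ)) f))
  instantiate-sound (A □→ φ) c f = □→-entails⨆ sem tt (instantiate-sound φ c f)

  instantiate-complete : ∀ φ c → Entails⨆ _⊨_ φ (λ f → instantiate f c φ)
  instantiate-complete (X ≐ x) c = Entails⨆-refl _⊨_ defaultInst
  instantiate-complete (dep [] X) c with findOcc σ d X (suc (c X))
  ... | nothing         = Entails⨆-refl _⊨_ defaultInst
  ... | just (i , refl) = Entails⨆-reindex _⊨_ (pointAt i)
                            (λ v → cong (occVar i ≐_) (sym (pointAt-self i v))) (const-elim sem)
  instantiate-complete (dep (_ ∷ _) X) c = Entails⨆-refl _⊨_ defaultInst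
  instantiate-complete (neg α) c = Entails⨆-refl _⊨_ defaultInst
  instantiate-complete (φ ∧ ψ) c = Entails⨆-reindex _⊨_ (uncurry (splice (advance c φ)))
    (λ (f , g) → sym (trans (instantiate-∧ _ c φ ψ) (uncurry (cong₂ _∧_) (instantiate-splice φ ψ c f g))))
    (∧-entails⨆ sem (instantiate-complete φ c) (instantiate-complete ψ (advance c φ)))
  instantiate-complete (φ ∨ ψ) c = Entails⨆-reindex _⊨_ (uncurry (splice (advance c φ)))
    (λ (f , g) → sym (trans (instantiate-∨ _ c φ ψ) (uncurry (cong₂ _∨_) (instantiate-splice φ ψ c f g))))
    (∨-entails⨆ sem (instantiate-complete φ c) (instantiate-complete ψ (advance c φ)))
  instantiate-complete (A □→ φ) c = □→-entails⨆ sem defaultInst (instantiate-complete φ c)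

  ⊨⇔⊨⨆instances : ∀ φ {T} → (T ⊨ φ → Σ (InstFun σ d) λ f → T ⊨ inst σ φ d f) ×
                             (Σ (InstFun σ d) (λ f → T ⊨ inst σ φ d f) → T ⊨ φ)
  ⊨⇔⊨⨆instances φ = instantiate-complete φ start , λ (f , h) → proj₂ (instantiate-sound φ start f h)
    where
      start : Counter
      start _ = 0

lemma5p15 : (σ : Sig) (φ : COD σ) (d : List (Occ σ)) →
            OccurrencesIn σ φ d →
            EquivGen⨆ σ φ (InstFun σ d) (inst σ φ d) ×
            EquivCausal⨆ σ φ (InstFun σ d) (inst σ φ d)
lemma5p15 σ φ d _ =
  (λ T _ → InstantiationEquivalence.⊨⇔⊨⨆instances gsat-compositional d φ) ,
  (λ F T _ → InstantiationEquivalence.⊨⇔⊨⨆instances csat-compositional d φ)
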